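{- Let $(\mathbb{X},\dagger)$ be a dagger category with finite $\dagger$-biproducts. A map $f: A\to B$ has a generalized singular value decomposition if and only if $f$ is Moore-Penrose split, $f$ has a $\dagger$-kernel $k: \mathsf{ker}(f)\to A$, and $f^\dagger$ has a $\dagger$-kernel $c: \mathsf{ker}(f^\dagger)\to B$, such that $ff^\circ + k^\dagger k = 1_A$ and $f^\circ f + c^\dagger c = 1_B$.
   Context: Composition is in diagrammatic order. A dagger category is a category with an identity-on-objects contravariant involutive functor $\dagger$. Isometry: $s: A\to B$ with $ss^\dagger = 1_A$; unitary: $u$ with $uu^\dagger = 1$, $u^\dagger u = 1$. Finite $\dagger$-biproducts: finite biproducts $\oplus$ (with zero object, zero maps $0$, and addition $+$ of parallel maps) whose projections $\pi_j$ and injections $\iota_j$ satisfy $\pi_j^\dagger = \iota_j$. A $\dagger$-kernel of $g: A\to B$ is a kernel $k: \mathsf{ker}(g) \to A$ of $g$ (so $kg = 0$ and $k$ is universal with this property) which is an isometry. A Moore-Penrose inverse of $f: A\to B$ is $f^\circ: B\to A$ with $ff^\circ f = f$, $f^\circ f f^\circ = f^\circ$, $(ff^\circ)^\dagger = ff^\circ$, $(f^\circ f)^\dagger = f^\circ f$. A $\dagger$-idempotent $e$ $\dagger$-splits if $e = rr^\dagger$ with $r^\dagger r = 1$; $f$ is Moore-Penrose split if it has a Moore-Penrose inverse $f^\circ$ and $ff^\circ$, $f^\circ f$ both $\dagger$-split. A generalized singular value decomposition of $f$ is a triple $(u: A\to X\oplus Z, d: X\to Y, v: Y\oplus W\to B)$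 with $u, v$ unitary, $d$ an isomorphism, and $f = u(d\oplus 0)v$. -}

module Defs where

open import Level using (Level; _⊔_; suc)
open import Data.Product using (Σ; Σ-syntax; _×_; _,_)
open import Relation.Binary.PropositionalEquality using (_≡_)

-- A dagger category with finite dagger-biproducts.
-- Composition is DIAGRAMMATIC:  f ⨾ g : A → C  for  f : A → B, g : B → C.
-- Hom-sets carry propositional equality.
record DaggerBiproductCategory (o ℓ : Level) : Set (suc (o ⊔ ℓ)) where
  infixl 20 _⨾_
  infixl 15 _+_
  infix 25 _†
  field
    Obj  : Set o
    Hom  : Obj → Obj → Set ℓ
    id   : ∀ {A} → Hom A A
    _⨾_  : ∀ {A B C} → Hom A B → Hom B C → Hom A C
    assoc  : ∀ {A B C D} (f : Hom A B) (g : Hom B C) (h : Hom C D) →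
             (f ⨾ g) ⨾ h ≡ f ⨾ (g ⨾ h)
    identityˡ : ∀ {A B} (f : Hom A B) → id ⨾ f ≡ f
    identityʳ : ∀ {A B} (f : Hom A B) → f ⨾ id ≡ f

    _†   : ∀ {A B} → Hom A B → Hom B A
    †-id     : ∀ {A} → (id {A}) † ≡ id
    †-comp   : ∀ {A B C} (f : Hom A B) (g : Hom B C) → (f ⨾ g) † ≡ (g †) ⨾ (f †)
    †-invol  : ∀ {A B} (f : Hom A B) → (f †) † ≡ f

    𝟎    : Obj
    !    : ∀ {A} → Hom A 𝟎
    !-unique : ∀ {A} (h : Hom A 𝟎) → h ≡ !
    ¡    : ∀ {A} → Hom 𝟎 A
    ¡-unique : ∀ {A} (h : Hom 𝟎 A) → h ≡ ¡

  0m : ∀ {A B} → Hom A B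
  0m = ! ⨾ ¡

  field
    _⊕_  : Obj → Obj → Obj
    π₁   : ∀ {A B} → Hom (A ⊕ B) A
    π₂   : ∀ {A B} → Hom (A ⊕ B) B
    ι₁   : ∀ {A B} → Hom A (A ⊕ B)
    ι₂   : ∀ {A B} → Hom B (A ⊕ B)
    ⟨_,_⟩ : ∀ {C A B} → Hom C A → Hom C B → Hom C (A ⊕ B)
    ⟨⟩-π₁ : ∀ {C A B} (f : Hom C A) (g : Hom C B) → ⟨ f , g ⟩ ⨾ π₁ ≡ f
    ⟨⟩-π₂ : ∀ {C A B} (f : Hom C A) (g : Hom C B) → ⟨ f , g ⟩ ⨾ π₂ ≡ g
    ⟨⟩-unique : ∀ {C A B} (f : Hom C A) (g : Hom C B) (h : Hom C (A ⊕ B)) →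
                h ⨾ π₁ ≡ f → h ⨾ π₂ ≡ g → h ≡ ⟨ f , g ⟩
    [_,_] : ∀ {A B C} → Hom A C → Hom B C → Hom (A ⊕ B) C
    ι₁-[] : ∀ {A B C} (f : Hom A C) (g : Hom B C) → ι₁ ⨾ [ f , g ] ≡ f
    ι₂-[] : ∀ {A B C} (f : Hom A C) (g : Hom B C) → ι₂ ⨾ [ f , g ] ≡ g
    []-unique : ∀ {A B C} (f : Hom A C) (g : Hom B C) (h : Hom (A ⊕ B) C) →
                ι₁ ⨾ h ≡ f → ι₂ ⨾ h ≡ g → h ≡ [ f , g ]
    ι₁π₁ : ∀ {A B} → ι₁ {A} {B} ⨾ π₁ ≡ id
    ι₂π₂ : ∀ {A B} → ι₂ {A} {B} ⨾ π₂ ≡ id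
    ι₁π₂ : ∀ {A B} → ι₁ {A} {B} ⨾ π₂ ≡ 0m
    ι₂π₁ : ∀ {A B} → ι₂ {A} {B} ⨾ π₁ ≡ 0m
    π₁† : ∀ {A B} → (π₁ {A} {B}) † ≡ ι₁
    π₂† : ∀ {A B} → (π₂ {A} {B}) † ≡ ι₂

  _+_ : ∀ {A B} → Hom A B → Hom A B → Hom A B
  f + g = ⟨ f , g ⟩ ⨾ [ id , id ]

  _⊕m_ : ∀ {A B C D} → Hom A B → Hom C D → Hom (A ⊕ C) (B ⊕ D)
  f ⊕m g = ⟨ π₁ ⨾ f , π₂ ⨾ g ⟩

module Notions {o ℓ} (𝕏 : DaggerBiproductCategory o ℓ) where
  open DaggerBiproductCategory 𝕏

  IsIsometry : ∀ {A B} → Hom A B → Set ℓ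
  IsIsometry s = s ⨾ (s †) ≡ id

  IsUnitary : ∀ {A B} → Hom A B → Set ℓ
  IsUnitary u = (u ⨾ (u †) ≡ id) × ((u †) ⨾ u ≡ id)

  IsIso : ∀ {A B} → Hom A B → Set ℓ
  IsIso {A} {B} d = Σ[ e ∈ Hom B A ] ((d ⨾ e ≡ id) × (e ⨾ d ≡ id))

  IsKernel : ∀ {K A B} → Hom K A → Hom A B → Set (o ⊔ ℓ)
  IsKernel {K} {A} k g =
    (k ⨾ g ≡ 0m) ×
    (∀ {C} (h : Hom C A) → h ⨾ g ≡ 0m →
       Σ[ m ∈ Hom C K ] ((m ⨾ k ≡ h) × (∀ (m' : Hom C K) → m' ⨾ k ≡ h → m' ≡ m)))

  IsDaggerKernel : ∀ {K A B} → Hom K A → Hom A B → Set (o ⊔ ℓ)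
  IsDaggerKernel k g = IsKernel k g × IsIsometry k

  IsMoorePenroseInverse : ∀ {A B} → Hom A B → Hom B A → Set ℓ
  IsMoorePenroseInverse f f° =
    (f ⨾ f° ⨾ f ≡ f) × (f° ⨾ f ⨾ f° ≡ f°) ×
    ((f ⨾ f°) † ≡ f ⨾ f°) × ((f° ⨾ f) † ≡ f° ⨾ f)

  DaggerSplits : ∀ {A} → Hom A A → Set (o ⊔ ℓ)
  DaggerSplits {A} e = Σ[ X ∈ Obj ] Σ[ r ∈ Hom A X ] ((e ≡ r ⨾ (r †)) × ((r †) ⨾ r ≡ id))

  IsMoorePenroseSplitWith : ∀ {A B} → Hom A B → Hom B A → Set (o ⊔ ℓ)
  IsMoorePenroseSplitWith f f° =
    IsMoorePenroseInverse f f° × DaggerSplits (f ⨾ f°) × DaggerSplits (f° ⨾ f)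

  HasGSVD : ∀ {A B} → Hom A B → Set (o ⊔ ℓ)
  HasGSVD {A} {B} f =
    Σ[ X ∈ Obj ] Σ[ Y ∈ Obj ] Σ[ Z ∈ Obj ] Σ[ W ∈ Obj ]
    Σ[ u ∈ Hom A (X ⊕ Z) ] Σ[ d ∈ Hom X Y ] Σ[ v ∈ Hom (Y ⊕ W) B ]
      (IsUnitary u × IsUnitary v × IsIso d × (f ≡ u ⨾ (d ⊕m (0m {Z} {W})) ⨾ v))

{-# OPTIONS --safe #-}
-- A unitary w : T → P ⊕ Q amounts to an orthogonal splitting of T: maps r = w π₁ and
-- k = ι₂ w† with r† r = 1, k k† = 1, k r = 0 and r r† + k† k = 1, and then k is a dagger
-- kernel of r, hence also of r g for every split mono g.
-- Given a GSVD, f = r d s† for the splittings r, s of u and v†, so f° = s d⁻¹ r† is a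
-- Moore-Penrose inverse with f f° = r r† and f° f = s s†, and the complements k of u and
-- of v† are dagger kernels of f and of f† = s d† r†.  Conversely, the dagger-splittings
-- of f f° and f° f together with the two kernels form orthogonal splittings of A and B;
-- their unitaries u, v and d = r† f s (inverse s† f° r) give f = u (d ⊕ 0) v.
module Submission where

open import Defs
open import Data.Product using (Σ; Σ-syntax; _×_; _,_; proj₁)
open import Level using (_⊔_)
open import Relation.Binary.PropositionalEquality using (_≡_; sym; trans; cong; cong₂; subst; module ≡-Reasoning)
open import Function.Bundles using (_⇔_; mk⇔)

module DaggerBiproductTheory {o ℓ} (𝕏 : DaggerBiproductCategory o ℓ) where
  open DaggerBiproductCategory 𝕏
  open Notions 𝕏
  open ≡-Reasoning

  private variable
    A B C D E K P Q T X Y Z W : Obj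

  cancelʳ : {b : Hom B C} {c : Hom C B} → b ⨾ c ≡ id → (a : Hom A B) → a ⨾ b ⨾ c ≡ a
  cancelʳ {b = b} {c} bc≡id a = trans (assoc a b c) (trans (cong (a ⨾_) bc≡id) (identityʳ a))

  cancelInner : {b : Hom B C} {c : Hom C B} → b ⨾ c ≡ id →
                (a : Hom A B) (d : Hom B D) → a ⨾ b ⨾ (c ⨾ d) ≡ a ⨾ d
  cancelInner {b = b} {c} bc≡id a d = begin
    a ⨾ b ⨾ (c ⨾ d)    ≡⟨ assoc a b (c ⨾ d) ⟩
    a ⨾ (b ⨾ (c ⨾ d))  ≡⟨ cong (a ⨾_) (assoc b c d) ⟨
    a ⨾ (b ⨾ c ⨾ d)    ≡⟨ cong (λ x → a ⨾ (x ⨾ d)) bc≡id ⟩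
    a ⨾ (id ⨾ d)       ≡⟨ cong (a ⨾_) (identityˡ d) ⟩
    a ⨾ d              ∎

  zeroʳ : (f : Hom A B) → f ⨾ 0m {B} {C} ≡ 0m
  zeroʳ f = trans (sym (assoc f ! ¡)) (cong (_⨾ ¡) (!-unique (f ⨾ !)))

  zeroˡ : (f : Hom B C) → 0m {A} {B} ⨾ f ≡ 0m
  zeroˡ f = trans (assoc ! ¡ f) (cong (! ⨾_) (¡-unique (¡ ⨾ f)))

  0m-† : 0m {A} {B} † ≡ 0m
  0m-† = trans (†-comp ! ¡) (cong₂ _⨾_ (!-unique _) (¡-unique _))

  ι₂† : ι₂ {A} {B} † ≡ π₂
  ι₂† = trans (cong _† (sym π₂†)) (†-invol π₂)

  †-⨾π₁ : (h : Hom A (P ⊕ Q)) → (h ⨾ π₁) † ≡ ι₁ ⨾ h †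
  †-⨾π₁ h = trans (†-comp h π₁) (cong (_⨾ h †) π₁†)

  †-ι₂⨾ : (h : Hom A (P ⊕ Q)) → (ι₂ ⨾ h †) † ≡ h ⨾ π₂
  †-ι₂⨾ h = trans (†-comp ι₂ (h †)) (cong₂ _⨾_ (†-invol h) ι₂†)

  †-⨾⨾† : (x : Hom A B) (y : Hom B C) (z : Hom D C) → (x ⨾ y ⨾ z †) † ≡ z ⨾ y † ⨾ x †
  †-⨾⨾† x y z = begin
    (x ⨾ y ⨾ z †) †      ≡⟨ †-comp (x ⨾ y) (z †) ⟩
    z † † ⨾ (x ⨾ y) †    ≡⟨ cong₂ _⨾_ (†-invol z) (†-comp x y) ⟩
    z ⨾ (y † ⨾ x †)      ≡⟨ assoc z (y †) (x †) ⟨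
    z ⨾ y † ⨾ x †        ∎

  ⨾†-selfAdjoint : (x : Hom A B) → (x ⨾ x †) † ≡ x ⨾ x †
  ⨾†-selfAdjoint x = trans (†-comp x (x †)) (cong (_⨾ x †) (†-invol x))

  ⨾⟨⟩ : (h : Hom D C) (f : Hom C A) (g : Hom C B) → h ⨾ ⟨ f , g ⟩ ≡ ⟨ h ⨾ f , h ⨾ g ⟩
  ⨾⟨⟩ h f g = ⟨⟩-unique _ _ _ (trans (assoc h _ π₁) (cong (h ⨾_) (⟨⟩-π₁ f g)))
                              (trans (assoc h _ π₂) (cong (h ⨾_) (⟨⟩-π₂ f g)))

  []⨾ : (f : Hom A C) (g : Hom B C) (h : Hom C D) → [ f , g ] ⨾ h ≡ [ f ⨾ h , g ⨾ h ]
  []⨾ f g h = []-unique _ _ _ (trans (sym (assoc ι₁ _ h)) (cong (_⨾ h) (ι₁-[] f g)))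
                              (trans (sym (assoc ι₂ _ h)) (cong (_⨾ h) (ι₂-[] f g)))

  ⟨⟩-† : (f : Hom C A) (g : Hom C B) → ⟨ f , g ⟩ † ≡ [ f † , g † ]
  ⟨⟩-† f g = []-unique _ _ _
    (trans (cong (_⨾ _) (sym π₁†)) (trans (sym (†-comp _ π₁)) (cong _† (⟨⟩-π₁ f g))))
    (trans (cong (_⨾ _) (sym π₂†)) (trans (sym (†-comp _ π₂)) (cong _† (⟨⟩-π₂ f g))))

  ⟨,0⟩ : (g : Hom C A) → ⟨ g , 0m {C} {B} ⟩ ≡ g ⨾ ι₁
  ⟨,0⟩ g = sym (⟨⟩-unique _ _ _ (trans (assoc g ι₁ π₁) (trans (cong (g ⨾_) ι₁π₁) (identityʳ g)))
                                 (trans (assoc g ι₁ π₂) (trans (cong (g ⨾_) ι₁π₂) (zeroʳ g))))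

  ⟨0,⟩ : (g : Hom C B) → ⟨ 0m {C} {A} , g ⟩ ≡ g ⨾ ι₂
  ⟨0,⟩ g = sym (⟨⟩-unique _ _ _ (trans (assoc g ι₂ π₁) (trans (cong (g ⨾_) ι₂π₁) (zeroʳ g)))
                                 (trans (assoc g ι₂ π₂) (trans (cong (g ⨾_) ι₂π₂) (identityʳ g))))

  ⟨⟩-⊕m : (a : Hom T A) (b : Hom T B) (c : Hom A C) (d : Hom B D) →
          ⟨ a , b ⟩ ⨾ (c ⊕m d) ≡ ⟨ a ⨾ c , b ⨾ d ⟩
  ⟨⟩-⊕m a b c d = trans (⨾⟨⟩ ⟨ a , b ⟩ (π₁ ⨾ c) (π₂ ⨾ d))
    (cong₂ ⟨_,_⟩ (trans (sym (assoc _ π₁ c)) (cong (_⨾ c) (⟨⟩-π₁ a b)))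
                 (trans (sym (assoc _ π₂ d)) (cong (_⨾ d) (⟨⟩-π₂ a b))))

  ι₁-⊕m : (c : Hom A C) (d : Hom B D) → ι₁ ⨾ (c ⊕m d) ≡ c ⨾ ι₁
  ι₁-⊕m c d = begin
    ι₁ ⨾ (c ⊕m d)                    ≡⟨ ⨾⟨⟩ ι₁ (π₁ ⨾ c) (π₂ ⨾ d) ⟩
    ⟨ ι₁ ⨾ (π₁ ⨾ c) , ι₁ ⨾ (π₂ ⨾ d) ⟩
      ≡⟨ cong₂ ⟨_,_⟩ (trans (sym (assoc ι₁ π₁ c)) (trans (cong (_⨾ c) ι₁π₁) (identityˡ c)))
                     (trans (sym (assoc ι₁ π₂ d)) (trans (cong (_⨾ d) ι₁π₂) (zeroˡ d))) ⟩
    ⟨ c , 0m ⟩                        ≡⟨ ⟨,0⟩ c ⟩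
    c ⨾ ι₁                            ∎

  ι₂-⊕m : (c : Hom A C) (d : Hom B D) → ι₂ ⨾ (c ⊕m d) ≡ d ⨾ ι₂
  ι₂-⊕m c d = begin
    ι₂ ⨾ (c ⊕m d)                    ≡⟨ ⨾⟨⟩ ι₂ (π₁ ⨾ c) (π₂ ⨾ d) ⟩
    ⟨ ι₂ ⨾ (π₁ ⨾ c) , ι₂ ⨾ (π₂ ⨾ d) ⟩
      ≡⟨ cong₂ ⟨_,_⟩ (trans (sym (assoc ι₂ π₁ c)) (trans (cong (_⨾ c) ι₂π₁) (zeroˡ c)))
                     (trans (sym (assoc ι₂ π₂ d)) (trans (cong (_⨾ d) ι₂π₂) (identityˡ d))) ⟩
    ⟨ 0m , d ⟩                        ≡⟨ ⟨0,⟩ d ⟩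
    d ⨾ ι₂                            ∎

  ⊕m-codiagonal : (c : Hom A C) (d : Hom B C) → (c ⊕m d) ⨾ [ id , id ] ≡ [ c , d ]
  ⊕m-codiagonal c d = []-unique c d _
    (trans (sym (assoc ι₁ _ _)) (trans (cong (_⨾ [ id , id ]) (ι₁-⊕m c d)) (cancelʳ (ι₁-[] id id) c)))
    (trans (sym (assoc ι₂ _ _)) (trans (cong (_⨾ [ id , id ]) (ι₂-⊕m c d)) (cancelʳ (ι₂-[] id id) d)))

  ⟨⟩⨾[] : (a : Hom T A) (b : Hom T B) (c : Hom A C) (d : Hom B C) →
          ⟨ a , b ⟩ ⨾ [ c , d ] ≡ a ⨾ c + b ⨾ d
  ⟨⟩⨾[] a b c d = begin
    ⟨ a , b ⟩ ⨾ [ c , d ]                 ≡⟨ cong (⟨ a , b ⟩ ⨾_) (⊕m-codiagonal c d) ⟨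
    ⟨ a , b ⟩ ⨾ ((c ⊕m d) ⨾ [ id , id ])  ≡⟨ assoc _ _ _ ⟨
    ⟨ a , b ⟩ ⨾ (c ⊕m d) ⨾ [ id , id ]    ≡⟨ cong (_⨾ [ id , id ]) (⟨⟩-⊕m a b c d) ⟩
    a ⨾ c + b ⨾ d                          ∎

  +-identityˡ : (g : Hom A B) → 0m + g ≡ g
  +-identityˡ g = trans (cong (_⨾ [ id , id ]) (⟨0,⟩ g)) (cancelʳ (ι₂-[] id id) g)

  ⨾-distribˡ-+ : (h : Hom C A) (f g : Hom A B) → h ⨾ (f + g) ≡ h ⨾ f + h ⨾ g
  ⨾-distribˡ-+ h f g = trans (sym (assoc h _ _)) (cong (_⨾ [ id , id ]) (⨾⟨⟩ h f g))

  ⨾-distribʳ-+ : (f g : Hom A B) (h : Hom B C) → (f + g) ⨾ h ≡ f ⨾ h + g ⨾ h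
  ⨾-distribʳ-+ f g h = begin
    ⟨ f , g ⟩ ⨾ [ id , id ] ⨾ h    ≡⟨ assoc _ _ _ ⟩
    ⟨ f , g ⟩ ⨾ ([ id , id ] ⨾ h)  ≡⟨ cong (⟨ f , g ⟩ ⨾_) ([]⨾ id id h) ⟩
    ⟨ f , g ⟩ ⨾ [ id ⨾ h , id ⨾ h ] ≡⟨ cong (λ x → ⟨ f , g ⟩ ⨾ [ x , x ]) (identityˡ h) ⟩
    ⟨ f , g ⟩ ⨾ [ h , h ]          ≡⟨ ⟨⟩⨾[] f g h h ⟩
    f ⨾ h + g ⨾ h                   ∎

  ⟨π₁,π₂⟩≡id : ⟨ π₁ , π₂ ⟩ ≡ id {P ⊕ Q}
  ⟨π₁,π₂⟩≡id = sym (⟨⟩-unique π₁ π₂ id (identityˡ π₁) (identityˡ π₂))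

  [ι₁,ι₂]≡id : [ ι₁ , ι₂ ] ≡ id {P ⊕ Q}
  [ι₁,ι₂]≡id = sym ([]-unique ι₁ ι₂ id (identityʳ ι₁) (identityʳ ι₂))

  π₁ι₁+π₂ι₂ : π₁ ⨾ ι₁ + π₂ ⨾ ι₂ ≡ id {P ⊕ Q}
  π₁ι₁+π₂ι₂ = begin
    π₁ ⨾ ι₁ + π₂ ⨾ ι₂          ≡⟨ ⟨⟩⨾[] π₁ π₂ ι₁ ι₂ ⟨
    ⟨ π₁ , π₂ ⟩ ⨾ [ ι₁ , ι₂ ]  ≡⟨ cong₂ _⨾_ ⟨π₁,π₂⟩≡id [ι₁,ι₂]≡id ⟩
    id ⨾ id                    ≡⟨ identityˡ id ⟩
    id                         ∎

  †-unitary : {w : Hom A B} → IsUnitary w → IsUnitary (w †)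
  †-unitary {w = w} (ww† , w†w) = trans (cong (w † ⨾_) (†-invol w)) w†w
                                , trans (cong (_⨾ w †) (†-invol w)) ww†

  ⊕m-0m-collapse : (u : Hom A (X ⊕ Z)) (d : Hom X Y) (v : Hom (Y ⊕ W) B) →
                   u ⨾ (d ⊕m 0m {Z} {W}) ⨾ v ≡ u ⨾ π₁ ⨾ d ⨾ (v † ⨾ π₁) †
  ⊕m-0m-collapse u d v = begin
    u ⨾ (d ⊕m 0m) ⨾ v              ≡⟨ cong (λ x → u ⨾ ⟨ π₁ ⨾ d , x ⟩ ⨾ v) (zeroʳ π₂) ⟩
    u ⨾ ⟨ π₁ ⨾ d , 0m ⟩ ⨾ v        ≡⟨ cong (λ x → u ⨾ x ⨾ v) (⟨,0⟩ (π₁ ⨾ d)) ⟩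
    u ⨾ (π₁ ⨾ d ⨾ ι₁) ⨾ v          ≡⟨ cong (_⨾ v) (assoc u _ ι₁) ⟨
    u ⨾ (π₁ ⨾ d) ⨾ ι₁ ⨾ v          ≡⟨ cong (λ x → x ⨾ ι₁ ⨾ v) (assoc u π₁ d) ⟨
    u ⨾ π₁ ⨾ d ⨾ ι₁ ⨾ v            ≡⟨ assoc _ ι₁ v ⟩
    u ⨾ π₁ ⨾ d ⨾ (ι₁ ⨾ v)          ≡⟨ cong (λ x → u ⨾ π₁ ⨾ d ⨾ (ι₁ ⨾ x)) (†-invol v) ⟨
    u ⨾ π₁ ⨾ d ⨾ (ι₁ ⨾ v † †)      ≡⟨ cong (u ⨾ π₁ ⨾ d ⨾_) (†-⨾π₁ (v †)) ⟨
    u ⨾ π₁ ⨾ d ⨾ (v † ⨾ π₁) †      ∎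

  kernel-⨾-splitMono : {k : Hom K A} {h : Hom A B} {g : Hom B C} {l : Hom C B} →
                       g ⨾ l ≡ id → IsKernel k h → IsKernel k (h ⨾ g)
  kernel-⨾-splitMono {k = k} {h} {g} {l} gl≡id (kh≡0 , universal) =
    trans (sym (assoc k h g)) (trans (cong (_⨾ g) kh≡0) (zeroˡ g)) ,
    λ x xhg≡0 → universal x (begin
      x ⨾ h          ≡⟨ cancelʳ gl≡id (x ⨾ h) ⟨
      x ⨾ h ⨾ g ⨾ l  ≡⟨ cong (_⨾ l) (trans (assoc x h g) xhg≡0) ⟩
      0m ⨾ l         ≡⟨ zeroˡ l ⟩
      0m             ∎)

  record OrthogonalSplitting (T P Q : Obj) : Set ℓ where
    field
      r : Hom T P
      k : Hom Q T
      r†r≡id : r † ⨾ r ≡ id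
      kk†≡id : k ⨾ k † ≡ id
      kr≡0 : k ⨾ r ≡ 0m
      rr†+k†k≡id : r ⨾ r † + k † ⨾ k ≡ id

    joint : Hom T (P ⊕ Q)
    joint = ⟨ r , k † ⟩

  unitary⇒splitting : (w : Hom T (P ⊕ Q)) → IsUnitary w → OrthogonalSplitting T P Q
  unitary⇒splitting w (ww† , w†w) = record
    { r = w ⨾ π₁
    ; k = ι₂ ⨾ w †
    ; r†r≡id = trans (cong (_⨾ (w ⨾ π₁)) (†-⨾π₁ w)) (trans (cancelInner w†w ι₁ π₁) ι₁π₁)
    ; kk†≡id = trans (cong (ι₂ ⨾ w † ⨾_) (†-ι₂⨾ w)) (trans (cancelInner w†w ι₂ π₂) ι₂π₂)
    ; kr≡0 = trans (cancelInner w†w ι₂ π₁) ι₂π₁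
    ; rr†+k†k≡id = resolution
    }
    where
    resolution : w ⨾ π₁ ⨾ (w ⨾ π₁) † + (ι₂ ⨾ w †) † ⨾ (ι₂ ⨾ w †) ≡ id
    resolution = begin
      w ⨾ π₁ ⨾ (w ⨾ π₁) † + (ι₂ ⨾ w †) † ⨾ (ι₂ ⨾ w †)
        ≡⟨ cong₂ _+_ (cong (w ⨾ π₁ ⨾_) (†-⨾π₁ w)) (cong (_⨾ (ι₂ ⨾ w †)) (†-ι₂⨾ w)) ⟩
      w ⨾ π₁ ⨾ (ι₁ ⨾ w †) + w ⨾ π₂ ⨾ (ι₂ ⨾ w †)
        ≡⟨ cong₂ _+_ (sym (assoc _ ι₁ (w †))) (sym (assoc _ ι₂ (w †))) ⟩
      w ⨾ π₁ ⨾ ι₁ ⨾ w † + w ⨾ π₂ ⨾ ι₂ ⨾ w †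
        ≡⟨ ⨾-distribʳ-+ _ _ (w †) ⟨
      (w ⨾ π₁ ⨾ ι₁ + w ⨾ π₂ ⨾ ι₂) ⨾ w †
        ≡⟨ cong (_⨾ w †) (cong₂ _+_ (assoc w π₁ ι₁) (assoc w π₂ ι₂)) ⟩
      (w ⨾ (π₁ ⨾ ι₁) + w ⨾ (π₂ ⨾ ι₂)) ⨾ w †
        ≡⟨ cong (_⨾ w †) (trans (sym (⨾-distribˡ-+ w _ _)) (cong (w ⨾_) π₁ι₁+π₂ι₂)) ⟩
      w ⨾ id ⨾ w †   ≡⟨ cong (_⨾ w †) (identityʳ w) ⟩
      w ⨾ w †        ≡⟨ ww† ⟩
      id             ∎

  module _ (S : OrthogonalSplitting T P Q) where
    open OrthogonalSplitting S

    joint-unitary : IsUnitary joint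
    joint-unitary = jj†≡id , trans ([]-unique ι₁ ι₂ (joint † ⨾ joint) ι₁-case ι₂-case) [ι₁,ι₂]≡id
      where
      j† : joint † ≡ [ r † , k ]
      j† = trans (⟨⟩-† r (k †)) (cong [ r † ,_] (†-invol k))

      jj†≡id : joint ⨾ joint † ≡ id
      jj†≡id = trans (cong (joint ⨾_) j†) (trans (⟨⟩⨾[] r (k †) (r †) k) rr†+k†k≡id)

      r†k†≡0 : r † ⨾ k † ≡ 0m
      r†k†≡0 = trans (sym (†-comp k r)) (trans (cong _† kr≡0) 0m-†)

      ι₁-case : ι₁ ⨾ (joint † ⨾ joint) ≡ ι₁
      ι₁-case = begin
        ι₁ ⨾ (joint † ⨾ joint)    ≡⟨ assoc ι₁ _ joint ⟨
        ι₁ ⨾ joint † ⨾ joint      ≡⟨ cong (λ x → ι₁ ⨾ x ⨾ joint) j† ⟩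
        ι₁ ⨾ [ r † , k ] ⨾ joint  ≡⟨ cong (_⨾ joint) (ι₁-[] (r †) k) ⟩
        r † ⨾ joint               ≡⟨ ⨾⟨⟩ (r †) r (k †) ⟩
        ⟨ r † ⨾ r , r † ⨾ k † ⟩   ≡⟨ cong₂ ⟨_,_⟩ r†r≡id r†k†≡0 ⟩
        ⟨ id , 0m ⟩               ≡⟨ ⟨,0⟩ id ⟩
        id ⨾ ι₁                   ≡⟨ identityˡ ι₁ ⟩
        ι₁                        ∎

      ι₂-case : ι₂ ⨾ (joint † ⨾ joint) ≡ ι₂
      ι₂-case = begin
        ι₂ ⨾ (joint † ⨾ joint)    ≡⟨ assoc ι₂ _ joint ⟨
        ι₂ ⨾ joint † ⨾ joint      ≡⟨ cong (λ x → ι₂ ⨾ x ⨾ joint) j† ⟩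
        ι₂ ⨾ [ r † , k ] ⨾ joint  ≡⟨ cong (_⨾ joint) (ι₂-[] (r †) k) ⟩
        k ⨾ joint                 ≡⟨ ⨾⟨⟩ k r (k †) ⟩
        ⟨ k ⨾ r , k ⨾ k † ⟩       ≡⟨ cong₂ ⟨_,_⟩ kr≡0 kk†≡id ⟩
        ⟨ 0m , id ⟩               ≡⟨ ⟨0,⟩ id ⟩
        id ⨾ ι₂                   ≡⟨ identityˡ ι₂ ⟩
        ι₂                        ∎

    k-daggerKernel-r : IsDaggerKernel k r
    k-daggerKernel-r = (kr≡0 , factor) , kk†≡id
      where
      factor : ∀ {C} (h : Hom C T) → h ⨾ r ≡ 0m →
               Σ[ m ∈ Hom C Q ] ((m ⨾ k ≡ h) × (∀ (m' : Hom C Q) → m' ⨾ k ≡ h → m' ≡ m))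
      factor h hr≡0 = h ⨾ k † , factorises ,
                      λ m' m'k≡h → trans (sym (cancelʳ kk†≡id m')) (cong (_⨾ k †) m'k≡h)
        where
        factorises : h ⨾ k † ⨾ k ≡ h
        factorises = begin
          h ⨾ k † ⨾ k                     ≡⟨ assoc h (k †) k ⟩
          h ⨾ (k † ⨾ k)                   ≡⟨ +-identityˡ _ ⟨
          0m + h ⨾ (k † ⨾ k)              ≡⟨ cong (_+ h ⨾ (k † ⨾ k)) (trans (sym (assoc h r (r †)))
                                                 (trans (cong (_⨾ r †) hr≡0) (zeroˡ (r †)))) ⟨
          h ⨾ (r ⨾ r †) + h ⨾ (k † ⨾ k)  ≡⟨ ⨾-distribˡ-+ h _ _ ⟨
          h ⨾ (r ⨾ r † + k † ⨾ k)        ≡⟨ cong (h ⨾_) rr†+k†k≡id ⟩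
          h ⨾ id                          ≡⟨ identityʳ h ⟩
          h                               ∎

    k-daggerKernel-r⨾ : {y : Hom P D} {w : Hom D P} {z : Hom E D} →
                        y ⨾ w ≡ id → z † ⨾ z ≡ id → IsDaggerKernel k (r ⨾ y ⨾ z †)
    k-daggerKernel-r⨾ {y = y} {w} {z} yw≡id z†z≡id =
      subst (IsDaggerKernel k) (sym (assoc r y (z †)))
        (kernel-⨾-splitMono (trans (cancelInner z†z≡id y w) yw≡id) (proj₁ k-daggerKernel-r) , kk†≡id)

  MoorePenroseSplitWithKernels : Hom A B → Set (o ⊔ ℓ)
  MoorePenroseSplitWithKernels {A} {B} f =
    Σ[ f° ∈ Hom B A ] (IsMoorePenroseSplitWith f f° ×
      (Σ[ K ∈ Obj ] Σ[ k ∈ Hom K A ] Σ[ C ∈ Obj ] Σ[ c ∈ Hom C B ]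
        (IsDaggerKernel k f × IsDaggerKernel c (f †) ×
         (f ⨾ f° + (k †) ⨾ k ≡ id) × (f° ⨾ f + (c †) ⨾ c ≡ id))))

  sandwich-cancel : {x : Hom T X} {y : Hom X Y} {z : Hom D Y} {w : Hom Y X} →
                    z † ⨾ z ≡ id → y ⨾ w ≡ id → x ⨾ y ⨾ z † ⨾ (z ⨾ w ⨾ x †) ≡ x ⨾ x †
  sandwich-cancel {x = x} {y} {z} {w} z†z≡id yw≡id = begin
    x ⨾ y ⨾ z † ⨾ (z ⨾ w ⨾ x †)    ≡⟨ cong (x ⨾ y ⨾ z † ⨾_) (assoc z w (x †)) ⟩
    x ⨾ y ⨾ z † ⨾ (z ⨾ (w ⨾ x †))  ≡⟨ cancelInner z†z≡id (x ⨾ y) (w ⨾ x †) ⟩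
    x ⨾ y ⨾ (w ⨾ x †)              ≡⟨ cancelInner yw≡id x (x †) ⟩
    x ⨾ x †                         ∎

  projection-absorbs : {a : Hom T X} → a † ⨾ a ≡ id →
                       (y : Hom X Y) (z : Hom Y D) → a ⨾ a † ⨾ (a ⨾ y ⨾ z) ≡ a ⨾ y ⨾ z
  projection-absorbs {a = a} a†a≡id y z =
    trans (cong (a ⨾ a † ⨾_) (assoc a y z)) (trans (cancelInner a†a≡id a (y ⨾ z)) (sym (assoc a y z)))

  module _ (S₁ : OrthogonalSplitting A X Z) (S₂ : OrthogonalSplitting B Y W)
           {d : Hom X Y} {e : Hom Y X} (de≡id : d ⨾ e ≡ id) (ed≡id : e ⨾ d ≡ id) where
    private
      module S₁ = OrthogonalSplitting S₁
      module S₂ = OrthogonalSplitting S₂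
      a : Hom A X
      a = S₁.r
      s : Hom B Y
      s = S₂.r

    polarForm-conditions : MoorePenroseSplitWithKernels (a ⨾ d ⨾ s †)
    polarForm-conditions =
      f° , (moorePenrose , (X , a , ff°≡aa† , S₁.r†r≡id) , (Y , s , f°f≡ss† , S₂.r†r≡id)) ,
      Z , S₁.k , W , S₂.k ,
      k-daggerKernel-r⨾ S₁ de≡id S₂.r†r≡id ,
      subst (IsDaggerKernel S₂.k) (sym (†-⨾⨾† a d s)) (k-daggerKernel-r⨾ S₂ d†e†≡id S₁.r†r≡id) ,
      trans (cong (_+ S₁.k † ⨾ S₁.k) ff°≡aa†) S₁.rr†+k†k≡id ,
      trans (cong (_+ S₂.k † ⨾ S₂.k) f°f≡ss†) S₂.rr†+k†k≡id
      where
      f : Hom A B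
      f = a ⨾ d ⨾ s †
      f° : Hom B A
      f° = s ⨾ e ⨾ a †

      ff°≡aa† : f ⨾ f° ≡ a ⨾ a †
      ff°≡aa† = sandwich-cancel S₂.r†r≡id de≡id

      f°f≡ss† : f° ⨾ f ≡ s ⨾ s †
      f°f≡ss† = sandwich-cancel S₁.r†r≡id ed≡id

      d†e†≡id : d † ⨾ e † ≡ id
      d†e†≡id = trans (sym (†-comp e d)) (trans (cong _† ed≡id) †-id)

      moorePenrose : IsMoorePenroseInverse f f°
      moorePenrose =
        trans (cong (_⨾ f) ff°≡aa†) (projection-absorbs S₁.r†r≡id d (s †)) ,
        trans (cong (_⨾ f°) f°f≡ss†) (projection-absorbs S₂.r†r≡id e (a †)) ,
        trans (cong _† ff°≡aa†) (trans (⨾†-selfAdjoint a) (sym ff°≡aa†)) ,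
        trans (cong _† f°f≡ss†) (trans (⨾†-selfAdjoint s) (sym f°f≡ss†))

  gsvd⇒conditions : (f : Hom A B) → HasGSVD f → MoorePenroseSplitWithKernels f
  gsvd⇒conditions f (_ , _ , _ , _ , u , d , v , u-unitary , v-unitary , (e , de≡id , ed≡id) , f≡udv) =
    subst MoorePenroseSplitWithKernels (sym (trans f≡udv (⊕m-0m-collapse u d v)))
      (polarForm-conditions (unitary⇒splitting u u-unitary)
                            (unitary⇒splitting (v †) (†-unitary v-unitary)) de≡id ed≡id)

  annihilates-split-range : {x : Hom C A} {f : Hom A B} {g : Hom B A} {r : Hom A X} →
                            x ⨾ f ≡ 0m → f ⨾ g ≡ r ⨾ r † → r † ⨾ r ≡ id → x ⨾ r ≡ 0m
  annihilates-split-range {x = x} {f} {g} {r} xf≡0 fg≡rr† r†r≡id = begin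
    x ⨾ r              ≡⟨ cong (x ⨾_) (cancelʳ r†r≡id r) ⟨
    x ⨾ (r ⨾ r † ⨾ r)  ≡⟨ cong (λ y → x ⨾ (y ⨾ r)) fg≡rr† ⟨
    x ⨾ (f ⨾ g ⨾ r)    ≡⟨ cong (x ⨾_) (assoc f g r) ⟩
    x ⨾ (f ⨾ (g ⨾ r))  ≡⟨ assoc x f (g ⨾ r) ⟨
    x ⨾ f ⨾ (g ⨾ r)    ≡⟨ cong (_⨾ (g ⨾ r)) xf≡0 ⟩
    0m ⨾ (g ⨾ r)       ≡⟨ zeroˡ (g ⨾ r) ⟩
    0m                 ∎

  annihilates-MP-inverse : {c : Hom C B} {f : Hom A B} {g : Hom B A} →
                           g ⨾ f ⨾ g ≡ g → (g ⨾ f) † ≡ g ⨾ f → c ⨾ f † ≡ 0m → c ⨾ g ≡ 0m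
  annihilates-MP-inverse {c = c} {f} {g} gfg≡g gf-selfAdjoint cf†≡0 = begin
    c ⨾ g                  ≡⟨ cong (c ⨾_) gfg≡g ⟨
    c ⨾ (g ⨾ f ⨾ g)        ≡⟨ cong (λ y → c ⨾ (y ⨾ g)) (trans (sym gf-selfAdjoint) (†-comp g f)) ⟩
    c ⨾ (f † ⨾ g † ⨾ g)    ≡⟨ cong (c ⨾_) (assoc (f †) (g †) g) ⟩
    c ⨾ (f † ⨾ (g † ⨾ g))  ≡⟨ assoc c (f †) (g † ⨾ g) ⟨
    c ⨾ f † ⨾ (g † ⨾ g)    ≡⟨ cong (_⨾ (g † ⨾ g)) cf†≡0 ⟩
    0m ⨾ (g † ⨾ g)         ≡⟨ zeroˡ (g † ⨾ g) ⟩
    0m                     ∎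

  compression-inverse : {f : Hom A B} {g : Hom B A} {r : Hom A X} {s : Hom B Y} →
                        f ⨾ g ⨾ f ≡ f → f ⨾ g ≡ r ⨾ r † → g ⨾ f ≡ s ⨾ s † → r † ⨾ r ≡ id →
                        r † ⨾ f ⨾ s ⨾ (s † ⨾ g ⨾ r) ≡ id
  compression-inverse {f = f} {g} {r} {s} fgf≡f fg≡rr† gf≡ss† r†r≡id = begin
    r † ⨾ f ⨾ s ⨾ (s † ⨾ g ⨾ r)      ≡⟨ assoc _ (s † ⨾ g) r ⟨
    r † ⨾ f ⨾ s ⨾ (s † ⨾ g) ⨾ r      ≡⟨ cong (_⨾ r) (assoc _ (s †) g) ⟨
    r † ⨾ f ⨾ s ⨾ s † ⨾ g ⨾ r        ≡⟨ cong (λ y → y ⨾ g ⨾ r) (assoc (r † ⨾ f) s (s †)) ⟩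
    r † ⨾ f ⨾ (s ⨾ s †) ⨾ g ⨾ r      ≡⟨ cong (λ y → r † ⨾ f ⨾ y ⨾ g ⨾ r) gf≡ss† ⟨
    r † ⨾ f ⨾ (g ⨾ f) ⨾ g ⨾ r        ≡⟨ cong (λ y → y ⨾ g ⨾ r) (trans (assoc (r †) f (g ⨾ f))
                                          (cong (r † ⨾_) (trans (sym (assoc f g f)) fgf≡f))) ⟩
    r † ⨾ f ⨾ g ⨾ r                  ≡⟨ cong (_⨾ r) (assoc (r †) f g) ⟩
    r † ⨾ (f ⨾ g) ⨾ r                ≡⟨ cong (λ y → r † ⨾ y ⨾ r) fg≡rr† ⟩
    r † ⨾ (r ⨾ r †) ⨾ r              ≡⟨ cong (_⨾ r) (assoc (r †) r (r †)) ⟨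
    r † ⨾ r ⨾ r † ⨾ r                ≡⟨ cong (λ y → y ⨾ r † ⨾ r) r†r≡id ⟩
    id ⨾ r † ⨾ r                     ≡⟨ cong (_⨾ r) (identityˡ (r †)) ⟩
    r † ⨾ r                          ≡⟨ r†r≡id ⟩
    id                               ∎

  compression-reconstructs : {f : Hom A B} {g : Hom B A} {r : Hom A X} {s : Hom B Y} →
                             f ⨾ g ⨾ f ≡ f → f ⨾ g ≡ r ⨾ r † → g ⨾ f ≡ s ⨾ s † →
                             r ⨾ (r † ⨾ f ⨾ s) ⨾ s † ≡ f
  compression-reconstructs {f = f} {g} {r} {s} fgf≡f fg≡rr† gf≡ss† = begin
    r ⨾ (r † ⨾ f ⨾ s) ⨾ s †  ≡⟨ cong (_⨾ s †) (assoc r _ s) ⟨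
    r ⨾ (r † ⨾ f) ⨾ s ⨾ s †  ≡⟨ cong (λ x → x ⨾ s ⨾ s †) (assoc r (r †) f) ⟨
    r ⨾ r † ⨾ f ⨾ s ⨾ s †    ≡⟨ assoc _ s (s †) ⟩
    r ⨾ r † ⨾ f ⨾ (s ⨾ s †)  ≡⟨ cong₂ (λ x y → x ⨾ f ⨾ y) fg≡rr† gf≡ss† ⟨
    f ⨾ g ⨾ f ⨾ (g ⨾ f)      ≡⟨ assoc _ g f ⟨
    f ⨾ g ⨾ f ⨾ g ⨾ f        ≡⟨ cong (λ x → x ⨾ g ⨾ f) fgf≡f ⟩
    f ⨾ g ⨾ f                ≡⟨ fgf≡f ⟩
    f                        ∎

  conditions⇒gsvd : (f : Hom A B) → MoorePenroseSplitWithKernels f → HasGSVD f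
  conditions⇒gsvd {A} {B} f
    (f° , ((fgf≡f , gfg≡g , _ , gf-selfAdjoint) , (X , r , ff°≡rr† , r†r≡id) , (Y , s , f°f≡ss† , s†s≡id)) ,
     K , k , C , c , ((kf≡0 , _) , kk†≡id) , ((cf†≡0 , _) , cc†≡id) , fg+k†k≡id , gf+c†c≡id) =
    X , Y , K , C , S₁.joint , r † ⨾ f ⨾ s , S₂.joint † ,
    joint-unitary S₁ , †-unitary (joint-unitary S₂) ,
    (s † ⨾ f° ⨾ r , compression-inverse fgf≡f ff°≡rr† f°f≡ss† r†r≡id ,
                    compression-inverse gfg≡g f°f≡ss† ff°≡rr† s†s≡id) ,
    f≡udv
    where
    S₁ : OrthogonalSplitting A X K
    S₁ = record
      { r = r ; k = k ; r†r≡id = r†r≡id ; kk†≡id = kk†≡id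
      ; kr≡0 = annihilates-split-range kf≡0 ff°≡rr† r†r≡id
      ; rr†+k†k≡id = trans (cong (_+ k † ⨾ k) (sym ff°≡rr†)) fg+k†k≡id
      }

    S₂ : OrthogonalSplitting B Y C
    S₂ = record
      { r = s ; k = c ; r†r≡id = s†s≡id ; kk†≡id = cc†≡id
      ; kr≡0 = annihilates-split-range (annihilates-MP-inverse gfg≡g gf-selfAdjoint cf†≡0)
                                       f°f≡ss† s†s≡id
      ; rr†+k†k≡id = trans (cong (_+ c † ⨾ c) (sym f°f≡ss†)) gf+c†c≡id
      }

    module S₁ = OrthogonalSplitting S₁
    module S₂ = OrthogonalSplitting S₂

    f≡udv : f ≡ S₁.joint ⨾ ((r † ⨾ f ⨾ s) ⊕m 0m {K} {C}) ⨾ S₂.joint †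
    f≡udv = sym (begin
      S₁.joint ⨾ ((r † ⨾ f ⨾ s) ⊕m 0m) ⨾ S₂.joint †
        ≡⟨ ⊕m-0m-collapse _ _ _ ⟩
      S₁.joint ⨾ π₁ ⨾ (r † ⨾ f ⨾ s) ⨾ (S₂.joint † † ⨾ π₁) †
        ≡⟨ cong₂ (λ x y → x ⨾ (r † ⨾ f ⨾ s) ⨾ y †) (⟨⟩-π₁ r (k †))
                 (trans (cong (_⨾ π₁) (†-invol S₂.joint)) (⟨⟩-π₁ s (c †))) ⟩
      r ⨾ (r † ⨾ f ⨾ s) ⨾ s †
        ≡⟨ compression-reconstructs fgf≡f ff°≡rr† f°f≡ss† ⟩
      f ∎)

open DaggerBiproductTheory using (gsvd⇒conditions; conditions⇒gsvd)

mainTheorem7 : ∀ {o ℓ} (𝕏 : DaggerBiproductCategory o ℓ)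
    {A B : DaggerBiproductCategory.Obj 𝕏} (f : DaggerBiproductCategory.Hom 𝕏 A B) →
    let open DaggerBiproductCategory 𝕏 in let open Notions 𝕏 in
    HasGSVD f ⇔
      (Σ[ f° ∈ Hom B A ] (IsMoorePenroseSplitWith f f° ×
        (Σ[ K ∈ Obj ] Σ[ k ∈ Hom K A ] Σ[ C ∈ Obj ] Σ[ c ∈ Hom C B ]
          (IsDaggerKernel k f × IsDaggerKernel c (f †) ×
           (f ⨾ f° + (k †) ⨾ k ≡ id) × (f° ⨾ f + (c †) ⨾ c ≡ id)))))
mainTheorem7 𝕏 f = mk⇔ (gsvd⇒conditions 𝕏 f) (conditions⇒gsvd 𝕏 f)
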